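{- Let $F_1,\dots,F_{12}$ be formulas of the propositional provability calculus such that, for each $i=1,\dots,12$, $F_i$ does not preserve the relation $R_i$ on $\mathfrak{B}_2$, where (with $\mathfrak{B}_2=\{\mathbb{0},\rho,\sigma,\mathbb{1}\}$): $R_1=\{\mathbb{0},\rho\}$, $R_2=\{\sigma,\mathbb{1}\}$, $R_3=\{\mathbb{0},\sigma\}$, $R_4=\{\mathbb{0},\mathbb{1}\}$, $R_5=\{\rho,\sigma\}$, $R_6=\{\rho,\mathbb{1}\}$, $R_7=\{\mathbb{0},\rho,\sigma\}$, $R_8=\{\mathbb{0},\rho,\mathbb{1}\}$, $R_9=\{\mathbb{0},\sigma,\mathbb{1}\}$, $R_{10}=\{\rho,\sigma,\mathbb{1}\}$ (unary relations), $R_{11}=\{(\mathbb{0},\rho),(\rho,\mathbb{0}),(\sigma,\mathbb{1}),(\mathbb{1},\sigma)\}$ and $R_{12}=\{(x,y):\Delta x\neq\Delta y\}=\{(\mathbb{0},\sigma),(\mathbb{0},\mathbb{1}),(\rho,\sigma),(\rho,\mathbb{1}),(\sigma,\mathbb{0}),(\sigma,\rho),(\mathbb{1},\mathbb{0}),(\mathbb{1},\rho)\}$ (binary relations). Then each of the constants $0,\rho,\sigma,1$ is expressible in the logic $L\mathfrak{B}_2$ via the formulas $F_1,\dots,F_{12}$.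
   Context: Formulas of the propositional provability calculus are built from propositional variables using $\&,\vee,\supset,\neg$ and the unary modal connective $\Delta$. The constant formulas $p\&\neg p$, $p\supset p$, $\Delta(p\&\neg p)$, $\neg\Delta(p\&\neg p)$ are denoted $0,1,\sigma,\rho$. The algebra $\mathfrak{B}_2=(\{\mathbb{0},\rho,\sigma,\mathbb{1}\};\&,\vee,\supset,\neg,\Delta)$ is the four-element Boolean algebra with least element $\mathbb{0}$, greatest element $\mathbb{1}$ and atoms $\rho,\sigma$ (so $\neg\rho=\sigma$), with usual Boolean operations and $\Delta\mathbb{0}=\Delta\rho=\sigma$, $\Delta\sigma=\Delta\mathbb{1}=\mathbb{1}$; the constant formulas $0,\rho,\sigma,1$ take the values $\mathbb{0},\rho,\sigma,\mathbb{1}$ respectively. $F[\alpha_1,\dots,\alpha_n]$ is the value of $F(p_1,\dots,p_n)$ on $\mathfrak{B}_2$ when $p_i$ takes value $\alpha_i$. $L\mathfrak{B}_2$ is the set of formulas taking value $\mathbb{1}$ under every evaluation on $\mathfrak{B}_2$; $A,B$ are equivalent in $L\mathfrak{B}_2$ if $(A\supset B)\&(B\supset A)\in L\mathfrak{B}_2$. A formula $F$ preserves an $m$-ary relation $R\subseteq\mathfrak{B}_2^m$ if for all $\alpha_{jk}\in\mathfrak{B}_2$ ($j=1,\dots,m$, $k=1,\dots,n$) such that $(\alpha_{1k},\dots,\alpha_{mk})\in R$ for every $k$, one has $(F[\alpha_{11},\dots,\alpha_{1n}],\dots,F[\alpha_{m1},\dots,\alpha_{mn}])\in R$. A formula $F$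 is expressible via a set of formulas $\Sigma$ in $L\mathfrak{B}_2$ if it belongs to the smallest set of formulas containing all propositional variables and all formulas of $\Sigma$ and closed under (a) weak substitution: from $A$ and $B$ obtain $A[p/B]$ (the result of substituting $B$ for a variable $p$ in $A$), and (b) replacement: from $A$ obtain any $B$ equivalent to $A$ in $L\mathfrak{B}_2$. A constant $c\in\{0,\rho,\sigma,1\}$ is expressible if some formula equivalent in $L\mathfrak{B}_2$ to the constant formula $c$ is expressible. -}

module Defs where

open import Data.Nat using (ℕ; zero; suc; _≟_)
open import Data.Fin using (Fin; zero; suc)
open import Data.Product using (_×_; _,_; ∃)
open import Data.List using (List; []; _∷_)
open import Data.List.Membership.Propositional using (_∈_)
open import Relation.Binary.PropositionalEquality using (_≡_)
open import Relation.Nullary using (¬_; yes; no)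

data Formula : Set where
  var  : ℕ → Formula
  _&_  : Formula → Formula → Formula
  _∨_  : Formula → Formula → Formula
  _⊃_  : Formula → Formula → Formula
  ¬ᶠ_  : Formula → Formula
  Δ_   : Formula → Formula

infixr 6 _&_
infixr 5 _∨_
infixr 4 _⊃_

p : Formula
p = var 0

0ᶠ 1ᶠ σᶠ ρᶠ : Formula
0ᶠ = p & ¬ᶠ p
1ᶠ = p ⊃ p
σᶠ = Δ (p & ¬ᶠ p)
ρᶠ = ¬ᶠ (Δ (p & ¬ᶠ p))

data B2 : Set where
  𝟘 ρ σ 𝟙 : B2

_∧ᵇ_ : B2 → B2 → B2
𝟘 ∧ᵇ y = 𝟘
𝟙 ∧ᵇ y = y
ρ ∧ᵇ 𝟘 = 𝟘
ρ ∧ᵇ ρ = ρ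
ρ ∧ᵇ σ = 𝟘
ρ ∧ᵇ 𝟙 = ρ
σ ∧ᵇ 𝟘 = 𝟘
σ ∧ᵇ ρ = 𝟘
σ ∧ᵇ σ = σ
σ ∧ᵇ 𝟙 = σ

¬ᵇ_ : B2 → B2
¬ᵇ 𝟘 = 𝟙
¬ᵇ ρ = σ
¬ᵇ σ = ρ
¬ᵇ 𝟙 = 𝟘

_∨ᵇ_ : B2 → B2 → B2
x ∨ᵇ y = ¬ᵇ ((¬ᵇ x) ∧ᵇ (¬ᵇ y))

_⊃ᵇ_ : B2 → B2 → B2
x ⊃ᵇ y = (¬ᵇ x) ∨ᵇ y

Δᵇ : B2 → B2
Δᵇ 𝟘 = σ
Δᵇ ρ = σ
Δᵇ σ = 𝟙
Δᵇ 𝟙 = 𝟙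

Valuation : Set
Valuation = ℕ → B2

⟦_⟧ : Formula → Valuation → B2
⟦ var n ⟧ v = v n
⟦ A & B ⟧ v = ⟦ A ⟧ v ∧ᵇ ⟦ B ⟧ v
⟦ A ∨ B ⟧ v = ⟦ A ⟧ v ∨ᵇ ⟦ B ⟧ v
⟦ A ⊃ B ⟧ v = ⟦ A ⟧ v ⊃ᵇ ⟦ B ⟧ v
⟦ ¬ᶠ A ⟧ v = ¬ᵇ (⟦ A ⟧ v)
⟦ Δ A ⟧ v = Δᵇ (⟦ A ⟧ v)

LB2 : Formula → Set
LB2 F = ∀ (v : Valuation) → ⟦ F ⟧ v ≡ 𝟙

Equiv : Formula → Formula → Set
Equiv A B = LB2 ((A ⊃ B) & (B ⊃ A))

_[_≔_] : Formula → ℕ → Formula → Formula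
var m [ n ≔ B ] with m ≟ n
... | yes _ = B
... | no  _ = var m
(A₁ & A₂) [ n ≔ B ] = (A₁ [ n ≔ B ]) & (A₂ [ n ≔ B ])
(A₁ ∨ A₂) [ n ≔ B ] = (A₁ [ n ≔ B ]) ∨ (A₂ [ n ≔ B ])
(A₁ ⊃ A₂) [ n ≔ B ] = (A₁ [ n ≔ B ]) ⊃ (A₂ [ n ≔ B ])
(¬ᶠ A) [ n ≔ B ] = ¬ᶠ (A [ n ≔ B ])
(Δ A) [ n ≔ B ] = Δ (A [ n ≔ B ])

data Expressible {k : ℕ} (Fs : Fin k → Formula) : Formula → Set where
  ex-var   : ∀ n → Expressible Fs (var n)
  ex-base  : ∀ i → Expressible Fs (Fs i)
  ex-subst : ∀ {A B} n → Expressible Fs A → Expressible Fs B →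
             Expressible Fs (A [ n ≔ B ])
  ex-repl  : ∀ {A B} → Expressible Fs A → Equiv A B → Expressible Fs B

constF : B2 → Formula
constF 𝟘 = 0ᶠ
constF ρ = ρᶠ
constF σ = σᶠ
constF 𝟙 = 1ᶠ

ExpressibleConst : {k : ℕ} → (Fin k → Formula) → B2 → Set
ExpressibleConst Fs c = ∃ λ G → Expressible Fs G × Equiv G (constF c)

Relation : ℕ → Set₁
Relation m = (Fin m → B2) → Set

Preserves : {m : ℕ} → Relation m → Formula → Set
Preserves {m} R F =
  ∀ (vs : Fin m → Valuation) →
    (∀ (k : ℕ) → R (λ j → vs j k)) →
    R (λ j → ⟦ F ⟧ (vs j))

unary : List B2 → Relation 1
unary xs t = t zero ∈ xs

binary : List (B2 × B2) → Relation 2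
binary xs t = (t zero , t (suc zero)) ∈ xs

R₁ R₂ R₃ R₄ R₅ R₆ R₇ R₈ R₉ R₁₀ : Relation 1
R₁  = unary (𝟘 ∷ ρ ∷ [])
R₂  = unary (σ ∷ 𝟙 ∷ [])
R₃  = unary (𝟘 ∷ σ ∷ [])
R₄  = unary (𝟘 ∷ 𝟙 ∷ [])
R₅  = unary (ρ ∷ σ ∷ [])
R₆  = unary (ρ ∷ 𝟙 ∷ [])
R₇  = unary (𝟘 ∷ ρ ∷ σ ∷ [])
R₈  = unary (𝟘 ∷ ρ ∷ 𝟙 ∷ [])
R₉  = unary (𝟘 ∷ σ ∷ 𝟙 ∷ [])
R₁₀ = unary (ρ ∷ σ ∷ 𝟙 ∷ [])

R₁₁ : Relation 2
R₁₁ = binary ((𝟘 , ρ) ∷ (ρ , 𝟘) ∷ (σ , 𝟙) ∷ (𝟙 , σ) ∷ [])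

R₁₂ : Relation 2
R₁₂ t = ¬ (Δᵇ (t zero) ≡ Δᵇ (t (suc zero)))

family12 : (F₁ F₂ F₃ F₄ F₅ F₆ F₇ F₈ F₉ F₁₀ F₁₁ F₁₂ : Formula) → Fin 12 → Formula
family12 F₁ F₂ F₃ F₄ F₅ F₆ F₇ F₈ F₉ F₁₀ F₁₁ F₁₂ i = lookup12 i
  where
  lookup12 : Fin 12 → Formula
  lookup12 zero = F₁
  lookup12 (suc zero) = F₂
  lookup12 (suc (suc zero)) = F₃
  lookup12 (suc (suc (suc zero))) = F₄
  lookup12 (suc (suc (suc (suc zero)))) = F₅
  lookup12 (suc (suc (suc (suc (suc zero))))) = F₆
  lookup12 (suc (suc (suc (suc (suc (suc zero)))))) = F₇
  lookup12 (suc (suc (suc (suc (suc (suc (suc zero))))))) = F₈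
  lookup12 (suc (suc (suc (suc (suc (suc (suc (suc zero)))))))) = F₉
  lookup12 (suc (suc (suc (suc (suc (suc (suc (suc (suc zero))))))))) = F₁₀
  lookup12 (suc (suc (suc (suc (suc (suc (suc (suc (suc (suc zero)))))))))) = F₁₁
  lookup12 (suc (suc (suc (suc (suc (suc (suc (suc (suc (suc (suc zero))))))))))) = F₁₂

-- Call a unary operation on 𝔅₂ definable if some expressible formula computes it
-- from the value of p₀. Definable operations are closed under composition and under
-- being plugged into the Fᵢ, and they respect the congruence ∼ with classes {𝟘, ρ}
-- and {σ, 𝟙}, since every connective does (Δ is constant on the quotient).
-- The failures of F₁, …, F₁₀ to preserve R₁, …, R₁₀ (through ∼ they also cover the
-- singletons) make the set of values reachable from any point by definable
-- operations grow until it is all of 𝔅₂. The failure of F₁₁ to commute with the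
-- swap τ inside the classes then yields, for any a ∼ b, a definable operation
-- identifying a and b, and the failure of F₁₂ to preserve ≁ yields, for any a and
-- b, one sending them into a common class. Composing such identifications gives a
-- constant definable operation, and following it by one reaching c gives a formula
-- equivalent to the constant c.

module Submission where

open import Data.Bool using (Bool; true; false; not; _∧_)
open import Data.Bool.Properties using (¬-not) renaming (_≟_ to _≟𝔹_)
open import Data.Fin using (Fin; zero; suc; #_)
open import Data.Fin.Subset using (Subset; inside; outside; _∪_; ⁅_⁆)
  renaming (_∈_ to _∈ˢ_; _∉_ to _∉ˢ_; _⊂_ to _⊂ˢ_; _⊃_ to _⊃ˢ_)
open import Data.Fin.Subset.Induction using (⊃-wellFounded; Acc; acc)
open import Data.Fin.Subset.Properties using (_∈?_; ∉⊥; ∈⊤; x∈p∪q⁺; x∈p∪q⁻; p⊆p∪q; x∈⁅x⁆; x∈⁅y⁆⇒x≡y)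
open import Data.List using (List; []; _∷_; filter)
open import Data.List.Membership.Propositional using (_∈_)
open import Data.List.Membership.Propositional.Properties using (∈-filter⁺; ∈-filter⁻)
open import Data.List.Relation.Unary.Any using (here; there)
open import Data.List.Relation.Unary.Any.Properties using (singleton⁻)
open import Data.Nat using (ℕ; zero; suc; _<_; _≤_; _⊔_; s≤s; _<?_) renaming (_≟_ to _≟ℕ_)
open import Data.Nat.Properties
  using (m<n⇒m<n⊔o; m<n⇒m<o⊔n; <⇒≢; ≮⇒≥; ≤-antisym; m<n⇒m<1+n; ≤-refl; <⇒≤; ≤-pred; ≤-reflexive)
open import Data.Product using (Σ-syntax; ∃; ∃₂; _×_; _,_; proj₁; proj₂; uncurry)
open import Data.Sum using (_⊎_; inj₁; inj₂)
open import Data.Vec using (Vec; []; _∷_; lookup)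
open import Data.Vec.Relation.Unary.All using (All; []; _∷_; all?)
open import Function using (_∘_)
open import Function.Bundles using (_⇔_; mk⇔; Equivalence)
open import Level using (0ℓ)
open import Relation.Binary using (DecidableEquality)
open import Relation.Binary.PropositionalEquality
  using (_≡_; _≢_; refl; sym; trans; cong; cong₂; subst; subst₂; module ≡-Reasoning)
open import Relation.Nullary using (¬_; Dec; yes; no; contradiction)
open import Relation.Nullary.Decidable using (map′; ¬?; _×-dec_; decidable-stable)
open import Relation.Unary using (Pred; Decidable; _≐_)

open import Defs

_≟_ : DecidableEquality B2
𝟘 ≟ 𝟘 = yes refl
𝟘 ≟ ρ = no λ ()
𝟘 ≟ σ = no λ ()
𝟘 ≟ 𝟙 = no λ ()
ρ ≟ 𝟘 = no λ ()
ρ ≟ ρ = yes refl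
ρ ≟ σ = no λ ()
ρ ≟ 𝟙 = no λ ()
σ ≟ 𝟘 = no λ ()
σ ≟ ρ = no λ ()
σ ≟ σ = yes refl
σ ≟ 𝟙 = no λ ()
𝟙 ≟ 𝟘 = no λ ()
𝟙 ≟ ρ = no λ ()
𝟙 ≟ σ = no λ ()
𝟙 ≟ 𝟙 = yes refl

upper : B2 → Bool
upper 𝟘 = false
upper ρ = false
upper σ = true
upper 𝟙 = true

infix 4 _∼_
_∼_ : B2 → B2 → Set
x ∼ y = upper x ≡ upper y

_∼?_ : ∀ x y → Dec (x ∼ y)
x ∼? y = upper x ≟𝔹 upper y

upper-¬ : ∀ x → upper (¬ᵇ x) ≡ not (upper x)
upper-¬ 𝟘 = refl
upper-¬ ρ = refl
upper-¬ σ = refl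
upper-¬ 𝟙 = refl

upper-∧ : ∀ x y → upper (x ∧ᵇ y) ≡ upper x ∧ upper y
upper-∧ 𝟘 y = refl
upper-∧ 𝟙 y = refl
upper-∧ ρ 𝟘 = refl
upper-∧ ρ ρ = refl
upper-∧ ρ σ = refl
upper-∧ ρ 𝟙 = refl
upper-∧ σ 𝟘 = refl
upper-∧ σ ρ = refl
upper-∧ σ σ = refl
upper-∧ σ 𝟙 = refl

upper-Δ : ∀ x → upper (Δᵇ x) ≡ true
upper-Δ 𝟘 = refl
upper-Δ ρ = refl
upper-Δ σ = refl
upper-Δ 𝟙 = refl

¬-resp-∼ : ∀ {x y} → x ∼ y → ¬ᵇ x ∼ ¬ᵇ y
¬-resp-∼ {x} {y} x∼y = trans (upper-¬ x) (trans (cong not x∼y) (sym (upper-¬ y)))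

∧-resp-∼ : ∀ {x x′ y y′} → x ∼ x′ → y ∼ y′ → x ∧ᵇ y ∼ x′ ∧ᵇ y′
∧-resp-∼ {x} {x′} {y} {y′} x∼x′ y∼y′ =
  trans (upper-∧ x y) (trans (cong₂ _∧_ x∼x′ y∼y′) (sym (upper-∧ x′ y′)))

Δ-∼ : ∀ x y → Δᵇ x ∼ Δᵇ y
Δ-∼ x y = trans (upper-Δ x) (sym (upper-Δ y))

δ : Bool → B2
δ false = σ
δ true = 𝟙

Δ-factors : ∀ x → Δᵇ x ≡ δ (upper x)
Δ-factors 𝟘 = refl
Δ-factors ρ = refl
Δ-factors σ = refl
Δ-factors 𝟙 = refl

δ-injective : ∀ {p q} → δ p ≡ δ q → p ≡ q
δ-injective {false} {false} _ = refl
δ-injective {true} {true} _ = refl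
δ-injective {false} {true} ()
δ-injective {true} {false} ()

Δ≡⇔∼ : ∀ {x y} → Δᵇ x ≡ Δᵇ y ⇔ x ∼ y
Δ≡⇔∼ {x} {y} = mk⇔ (λ e → δ-injective (trans (sym (Δ-factors x)) (trans e (Δ-factors y))))
                   (λ x∼y → trans (Δ-factors x) (trans (cong δ x∼y) (sym (Δ-factors y))))

τ : B2 → B2
τ 𝟘 = ρ
τ ρ = 𝟘
τ σ = 𝟙
τ 𝟙 = σ

same-class : ∀ x y → y ∼ x → y ≡ x ⊎ y ≡ τ x
same-class 𝟘 𝟘 _ = inj₁ refl
same-class 𝟘 ρ _ = inj₂ refl
same-class ρ 𝟘 _ = inj₂ refl
same-class ρ ρ _ = inj₁ refl
same-class σ σ _ = inj₁ refl
same-class σ 𝟙 _ = inj₂ refl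
same-class 𝟙 σ _ = inj₂ refl
same-class 𝟙 𝟙 _ = inj₁ refl
same-class 𝟘 σ ()
same-class 𝟘 𝟙 ()
same-class ρ σ ()
same-class ρ 𝟙 ()
same-class σ 𝟘 ()
same-class σ ρ ()
same-class 𝟙 𝟘 ()
same-class 𝟙 ρ ()

_[_↦_] : Valuation → ℕ → B2 → Valuation
(v [ n ↦ x ]) m with m ≟ℕ n
... | yes _ = x
... | no _ = v m

set-same : ∀ v n x → (v [ n ↦ x ]) n ≡ x
set-same v n x with n ≟ℕ n
... | yes _ = refl
... | no n≢n = contradiction refl n≢n

set-other : ∀ v {m n} x → m ≢ n → (v [ n ↦ x ]) m ≡ v m
set-other v {m} {n} x m≢n with m ≟ℕ n
... | yes m≡n = contradiction m≡n m≢n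
... | no _ = refl

support : Formula → ℕ
support (var n) = suc n
support (A & B) = support A ⊔ support B
support (A ∨ B) = support A ⊔ support B
support (A ⊃ B) = support A ⊔ support B
support (¬ᶠ A) = support A
support (Δ A) = support A

⟦⟧-local : ∀ A {v w} → (∀ k → k < support A → v k ≡ w k) → ⟦ A ⟧ v ≡ ⟦ A ⟧ w
⟦⟧-local (var n) v≗w = v≗w n ≤-refl
⟦⟧-local (A & B) v≗w =
  cong₂ _∧ᵇ_ (⟦⟧-local A (λ k → v≗w k ∘ m<n⇒m<n⊔o _)) (⟦⟧-local B (λ k → v≗w k ∘ m<n⇒m<o⊔n _))
⟦⟧-local (A ∨ B) v≗w =
  cong₂ _∨ᵇ_ (⟦⟧-local A (λ k → v≗w k ∘ m<n⇒m<n⊔o _)) (⟦⟧-local B (λ k → v≗w k ∘ m<n⇒m<o⊔n _))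
⟦⟧-local (A ⊃ B) v≗w =
  cong₂ _⊃ᵇ_ (⟦⟧-local A (λ k → v≗w k ∘ m<n⇒m<n⊔o _)) (⟦⟧-local B (λ k → v≗w k ∘ m<n⇒m<o⊔n _))
⟦⟧-local (¬ᶠ A) v≗w = cong ¬ᵇ_ (⟦⟧-local A v≗w)
⟦⟧-local (Δ A) v≗w = cong Δᵇ (⟦⟧-local A v≗w)

⟦⟧-cong : ∀ A {v w} → (∀ k → v k ≡ w k) → ⟦ A ⟧ v ≡ ⟦ A ⟧ w
⟦⟧-cong A v≗w = ⟦⟧-local A (λ k _ → v≗w k)

⟦⟧-subst : ∀ A n B v → ⟦ A [ n ≔ B ] ⟧ v ≡ ⟦ A ⟧ (v [ n ↦ ⟦ B ⟧ v ])
⟦⟧-subst (var m) n B v with m ≟ℕ n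
... | yes _ = refl
... | no _ = refl
⟦⟧-subst (A₁ & A₂) n B v = cong₂ _∧ᵇ_ (⟦⟧-subst A₁ n B v) (⟦⟧-subst A₂ n B v)
⟦⟧-subst (A₁ ∨ A₂) n B v = cong₂ _∨ᵇ_ (⟦⟧-subst A₁ n B v) (⟦⟧-subst A₂ n B v)
⟦⟧-subst (A₁ ⊃ A₂) n B v = cong₂ _⊃ᵇ_ (⟦⟧-subst A₁ n B v) (⟦⟧-subst A₂ n B v)
⟦⟧-subst (¬ᶠ A) n B v = cong ¬ᵇ_ (⟦⟧-subst A n B v)
⟦⟧-subst (Δ A) n B v = cong Δᵇ (⟦⟧-subst A n B v)

-- _∨ᵇ_ and _⊃ᵇ_ unfold to ¬ᵇ_ and _∧ᵇ_.
⟦⟧-resp-∼ : ∀ A {v w} → (∀ k → v k ∼ w k) → ⟦ A ⟧ v ∼ ⟦ A ⟧ w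
⟦⟧-resp-∼ (var n) v∼w = v∼w n
⟦⟧-resp-∼ (A & B) v∼w = ∧-resp-∼ (⟦⟧-resp-∼ A v∼w) (⟦⟧-resp-∼ B v∼w)
⟦⟧-resp-∼ (A ∨ B) v∼w =
  ¬-resp-∼ (∧-resp-∼ (¬-resp-∼ (⟦⟧-resp-∼ A v∼w)) (¬-resp-∼ (⟦⟧-resp-∼ B v∼w)))
⟦⟧-resp-∼ (A ⊃ B) v∼w =
  ¬-resp-∼ (∧-resp-∼ (¬-resp-∼ (¬-resp-∼ (⟦⟧-resp-∼ A v∼w))) (¬-resp-∼ (⟦⟧-resp-∼ B v∼w)))
⟦⟧-resp-∼ (¬ᶠ A) v∼w = ¬-resp-∼ (⟦⟧-resp-∼ A v∼w)
⟦⟧-resp-∼ (Δ A) {v} {w} _ = Δ-∼ (⟦ A ⟧ v) (⟦ A ⟧ w)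

Searchable : Set → Set₁
Searchable A = ∀ {P : Pred A 0ℓ} → Decidable P → Dec (∃ P)

search-B2 : Searchable B2
search-B2 P? with P? 𝟘 | P? ρ | P? σ | P? 𝟙
... | yes p | _ | _ | _ = yes (𝟘 , p)
... | _ | yes p | _ | _ = yes (ρ , p)
... | _ | _ | yes p | _ = yes (σ , p)
... | _ | _ | _ | yes p = yes (𝟙 , p)
... | no ¬p₀ | no ¬p₁ | no ¬p₂ | no ¬p₃ =
  no λ { (𝟘 , p) → ¬p₀ p ; (ρ , p) → ¬p₁ p ; (σ , p) → ¬p₂ p ; (𝟙 , p) → ¬p₃ p }

search-× : ∀ {A B} → Searchable A → Searchable B → Searchable (A × B)
search-× search-A search-B P? =
  map′ (λ { (a , b , p) → (a , b) , p }) (λ { ((a , b) , p) → a , b , p })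
       (search-A λ a → search-B λ b → P? (a , b))

search-Vec : ∀ {A} → Searchable A → ∀ n → Searchable (Vec A n)
search-Vec search zero P? = map′ ([] ,_) (λ { ([] , p) → p }) (P? [])
search-Vec search (suc n) P? =
  map′ (λ { (x , xs , p) → x ∷ xs , p }) (λ { (x ∷ xs , p) → x , xs , p })
       (search λ x → search-Vec search n (λ xs → P? (x ∷ xs)))

module _ {A : Set} (default : A) where

  padded : ∀ {n} → Vec A n → ℕ → A
  padded [] _ = default
  padded (x ∷ xs) zero = x
  padded (x ∷ xs) (suc k) = padded xs k

  prefix : ∀ n → (ℕ → A) → Vec A n
  prefix zero c = []
  prefix (suc n) c = c 0 ∷ prefix n (c ∘ suc)

  padded-prefix : ∀ n c k → k < n → padded (prefix n c) k ≡ c k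
  padded-prefix (suc n) c zero _ = refl
  padded-prefix (suc n) c (suc k) (s≤s k<n) = padded-prefix n (c ∘ suc) k k<n

  padded-All : ∀ {G : Pred A 0ℓ} → G default → ∀ {n} {xs : Vec A n} → All G xs → ∀ k → G (padded xs k)
  padded-All G-default [] _ = G-default
  padded-All G-default (Gx ∷ _) zero = Gx
  padded-All G-default (_ ∷ Gxs) (suc k) = padded-All G-default Gxs k

  prefix-All : ∀ {G : Pred A 0ℓ} n {c} → (∀ k → G (c k)) → All G (prefix n c)
  prefix-All zero _ = []
  prefix-All (suc n) Gc = Gc 0 ∷ prefix-All n (Gc ∘ suc)

module _ {A : Set} (search : Searchable A) {G : Pred A 0ℓ} (G? : Decidable G)
         {default : A} (G-default : G default) where

  -- A failure of a property of sequences that depends only on their first N terms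
  -- is witnessed by a sequence that is eventually constant, hence found by finite search.
  counterexample : ∀ N {P : (ℕ → A) → Set} → (∀ c → Dec (P c)) →
                   (∀ {c c′} → (∀ k → k < N → c k ≡ c′ k) → P c → P c′) →
                   ¬ (∀ c → (∀ k → G (c k)) → P c) → ∃ λ c → (∀ k → G (c k)) × ¬ P c
  counterexample N {P} P? P-local ¬∀
    with search-Vec search N (λ xs → all? G? xs ×-dec ¬? (P? (padded default xs)))
  ... | yes (xs , Gxs , ¬P) = padded default xs , padded-All default G-default Gxs , ¬P
  ... | no ∄ = contradiction holds ¬∀
    where
    holds : ∀ c → (∀ k → G (c k)) → P c
    holds c Gc = decidable-stable (P? c) λ ¬Pc →
      ∄ (prefix default N c , prefix-All default N Gc ,
         ¬Pc ∘ P-local (padded-prefix default N c))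

relation₁ : Pred B2 0ℓ → Relation 1
relation₁ P t = P (t zero)

relation₂ : (B2 → B2 → Set) → Relation 2
relation₂ P t = P (t zero) (t (suc zero))

counterexample₁ : ∀ {P : Pred B2 0ℓ} → Decidable P → ∀ {a} → P a → ∀ F →
                  ¬ Preserves (relation₁ P) F →
                  ∃ λ v → (∀ k → P (v k)) × ¬ P (⟦ F ⟧ v)
counterexample₁ {P} P? Pa F unpreserved =
  counterexample search-B2 P? Pa (support F) (λ v → P? (⟦ F ⟧ v))
    (λ agree → subst P (⟦⟧-local F agree)) (λ preserved → unpreserved (preserved ∘ λ vs → vs zero))

counterexample₂ : ∀ {P : B2 → B2 → Set} → (∀ x y → Dec (P x y)) → ∀ {a b} → P a b → ∀ F →
                  ¬ Preserves (relation₂ P) F →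
                  ∃₂ λ v w → (∀ k → P (v k) (w k)) × ¬ P (⟦ F ⟧ v) (⟦ F ⟧ w)
counterexample₂ {P} P? Pab F unpreserved
  with counterexample (search-× search-B2 search-B2) (uncurry P?) Pab (support F)
         (λ c → P? (⟦ F ⟧ (proj₁ ∘ c)) (⟦ F ⟧ (proj₂ ∘ c)))
         (λ agree → subst₂ P (⟦⟧-local F (λ k → cong proj₁ ∘ agree k))
                             (⟦⟧-local F (λ k → cong proj₂ ∘ agree k)))
         (λ preserved → unpreserved λ vs → preserved (λ k → vs zero k , vs (suc zero) k))
... | c , Pc , ¬P = proj₁ ∘ c , proj₂ ∘ c , Pc , ¬P

Preserves-resp-≐ : ∀ {m} {R R′ : Relation m} → R ≐ R′ → ∀ {F} → Preserves R F → Preserves R′ F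
Preserves-resp-≐ (R⊆R′ , R′⊆R) preserved vs R′-columns = R⊆R′ (preserved vs (R′⊆R ∘ R′-columns))

pair : B2 → B2 → Fin 2 → B2
pair x y zero = x
pair x y (suc _) = y

R₁₁⇒τ-graph : ∀ {x y} → R₁₁ (pair x y) → y ≡ τ x
R₁₁⇒τ-graph (here refl) = refl
R₁₁⇒τ-graph (there (here refl)) = refl
R₁₁⇒τ-graph (there (there (here refl))) = refl
R₁₁⇒τ-graph (there (there (there (here refl)))) = refl

τ-graph⇒R₁₁ : ∀ x → R₁₁ (pair x (τ x))
τ-graph⇒R₁₁ 𝟘 = here refl
τ-graph⇒R₁₁ ρ = there (here refl)
τ-graph⇒R₁₁ σ = there (there (here refl))
τ-graph⇒R₁₁ 𝟙 = there (there (there (here refl)))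

τ-graph≐R₁₁ : relation₂ (λ x y → y ≡ τ x) ≐ R₁₁
τ-graph≐R₁₁ = (λ {t} e → subst (λ y → R₁₁ (pair (t zero) y)) (sym e) (τ-graph⇒R₁₁ (t zero)))
            , R₁₁⇒τ-graph

other-class≐R₁₂ : relation₂ (λ x y → ¬ x ∼ y) ≐ R₁₂
other-class≐R₁₂ = (λ ≁ → ≁ ∘ Equivalence.to Δ≡⇔∼) , (λ Δ≢ → Δ≢ ∘ Equivalence.from Δ≡⇔∼)

τ-counterexample : ∀ F → ¬ Preserves R₁₁ F → ∃ λ v → ⟦ F ⟧ (τ ∘ v) ≢ τ (⟦ F ⟧ v)
τ-counterexample F unpreserved
  with counterexample₂ (λ x y → y ≟ τ x) {𝟘} refl F (unpreserved ∘ Preserves-resp-≐ τ-graph≐R₁₁ {F})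
... | v , w , w≡τv , Fw≢τFv = v , Fw≢τFv ∘ trans (⟦⟧-cong F w≡τv)

class-merging-counterexample : ∀ F → ¬ Preserves R₁₂ F →
                               ∃₂ λ v w → (∀ k → ¬ v k ∼ w k) × ⟦ F ⟧ v ∼ ⟦ F ⟧ w
class-merging-counterexample F unpreserved
  with counterexample₂ (λ x y → ¬? (x ∼? y)) {𝟘} {σ} (λ ()) F
         (unpreserved ∘ Preserves-resp-≐ other-class≐R₁₂ {F})
... | v , w , v≁w , ¬≁ = v , w , v≁w , decidable-stable (_ ∼? _) ¬≁

lower-class : ∀ y → y ∈ 𝟘 ∷ ρ ∷ [] ⇔ y ∼ 𝟘
lower-class 𝟘 = mk⇔ (λ _ → refl) (λ _ → here refl)
lower-class ρ = mk⇔ (λ _ → refl) (λ _ → there (here refl))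
lower-class σ = mk⇔ (λ { (here ()) ; (there (here ())) }) (λ ())
lower-class 𝟙 = mk⇔ (λ { (here ()) ; (there (here ())) }) (λ ())

upper-class : ∀ y → y ∈ σ ∷ 𝟙 ∷ [] ⇔ y ∼ 𝟙
upper-class 𝟘 = mk⇔ (λ { (here ()) ; (there (here ())) }) (λ ())
upper-class ρ = mk⇔ (λ { (here ()) ; (there (here ())) }) (λ ())
upper-class σ = mk⇔ (λ _ → refl) (λ _ → here refl)
upper-class 𝟙 = mk⇔ (λ _ → refl) (λ _ → there (here refl))

-- A formula fixing x maps the class of x into itself, because it respects ∼.
singleton-unpreserved : ∀ {xs x F} → (∀ y → y ∈ xs ⇔ y ∼ x) →
                        ¬ Preserves (unary xs) F → ¬ Preserves (unary (x ∷ [])) F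
singleton-unpreserved {xs} {x} {F} class unpreserved fixes-x = unpreserved λ vs in-class →
  Equivalence.from (class _)
    (trans (⟦⟧-resp-∼ F (λ k → Equivalence.to (class _) (in-class k)))
           (cong upper (singleton⁻ (fixes-x (λ _ _ → x) (λ _ → here refl)))))

index : B2 → Fin 4
index 𝟘 = # 0
index ρ = # 1
index σ = # 2
index 𝟙 = # 3

index-injective : ∀ {x y} → index x ≡ index y → x ≡ y
index-injective {x} {y} e = trans (sym (decode-index x)) (trans (cong decode e) (decode-index y))
  where
  decode : Fin 4 → B2
  decode = lookup (𝟘 ∷ ρ ∷ σ ∷ 𝟙 ∷ [])
  decode-index : ∀ x → decode (index x) ≡ x
  decode-index 𝟘 = refl
  decode-index ρ = refl
  decode-index σ = refl
  decode-index 𝟙 = refl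

all-B2 : List B2
all-B2 = 𝟘 ∷ ρ ∷ σ ∷ 𝟙 ∷ []

∈-all-B2 : ∀ y → y ∈ all-B2
∈-all-B2 𝟘 = here refl
∈-all-B2 ρ = there (here refl)
∈-all-B2 σ = there (there (here refl))
∈-all-B2 𝟙 = there (there (there (here refl)))

elements : Subset 4 → List B2
elements S = filter (λ y → index y ∈? S) all-B2

elements≐ : ∀ S → relation₁ (λ y → index y ∈ˢ S) ≐ unary (elements S)
elements≐ S = (λ {t} → ∈-filter⁺ (λ y → index y ∈? S) (∈-all-B2 (t zero)))
            , (proj₂ ∘ ∈-filter⁻ (λ y → index y ∈? S) {xs = all-B2})

∧ᵇ-¬ᵇ : ∀ x → x ∧ᵇ (¬ᵇ x) ≡ 𝟘
∧ᵇ-¬ᵇ 𝟘 = refl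
∧ᵇ-¬ᵇ ρ = refl
∧ᵇ-¬ᵇ σ = refl
∧ᵇ-¬ᵇ 𝟙 = refl

⊃ᵇ-refl : ∀ x → x ⊃ᵇ x ≡ 𝟙
⊃ᵇ-refl 𝟘 = refl
⊃ᵇ-refl ρ = refl
⊃ᵇ-refl σ = refl
⊃ᵇ-refl 𝟙 = refl

⟦constF⟧ : ∀ c v → ⟦ constF c ⟧ v ≡ c
⟦constF⟧ 𝟘 v = ∧ᵇ-¬ᵇ (v 0)
⟦constF⟧ ρ v = cong (¬ᵇ_ ∘ Δᵇ) (∧ᵇ-¬ᵇ (v 0))
⟦constF⟧ σ v = cong Δᵇ (∧ᵇ-¬ᵇ (v 0))
⟦constF⟧ 𝟙 v = ⊃ᵇ-refl (v 0)

≗⇒Equiv : ∀ {A B} → (∀ v → ⟦ A ⟧ v ≡ ⟦ B ⟧ v) → Equiv A B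
≗⇒Equiv {A} {B} A≗B v =
  trans (cong (λ a → (a ⊃ᵇ ⟦ B ⟧ v) ∧ᵇ (⟦ B ⟧ v ⊃ᵇ a)) (A≗B v))
        (cong₂ _∧ᵇ_ (⊃ᵇ-refl (⟦ B ⟧ v)) (⊃ᵇ-refl (⟦ B ⟧ v)))

module Definability {n} (Fs : Fin n → Formula) where

  Definable : (Valuation → B2) → Set
  Definable φ = Σ[ A ∈ Formula ] Expressible Fs A × (∀ v → ⟦ A ⟧ v ≡ φ v)

  var-definable : ∀ n → Definable (λ v → v n)
  var-definable n = var n , ex-var n , λ _ → refl

  ⟦⟧-definable : ∀ {A} → Expressible Fs A → Definable ⟦ A ⟧
  ⟦⟧-definable {A} A-expr = A , A-expr , λ _ → refl

  definable-≗ : ∀ {φ ψ} → Definable φ → (∀ v → φ v ≡ ψ v) → Definable ψ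
  definable-≗ (A , A-expr , A≗φ) φ≗ψ = A , A-expr , λ v → trans (A≗φ v) (φ≗ψ v)

  subst-definable : ∀ {φ ψ} n → Definable φ → Definable ψ → Definable (λ v → φ (v [ n ↦ ψ v ]))
  subst-definable {φ} {ψ} n (A , A-expr , A≗φ) (B , B-expr , B≗ψ) =
    A [ n ≔ B ] , ex-subst n A-expr B-expr , λ v → begin
      ⟦ A [ n ≔ B ] ⟧ v         ≡⟨ ⟦⟧-subst A n B v ⟩
      ⟦ A ⟧ (v [ n ↦ ⟦ B ⟧ v ]) ≡⟨ cong (λ x → ⟦ A ⟧ (v [ n ↦ x ])) (B≗ψ v) ⟩
      ⟦ A ⟧ (v [ n ↦ ψ v ])     ≡⟨ A≗φ (v [ n ↦ ψ v ]) ⟩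
      φ (v [ n ↦ ψ v ])         ∎
    where open ≡-Reasoning

  -- Variables 0, …, N − 1 are replaced one at a time while the argument is parked in
  -- the fresh variable N (renamed back to 0 at the end), so that no substitution
  -- acts on an already substituted formula.
  compose-definable : ∀ {φ} (g : ℕ → B2 → B2) → Definable φ → (∀ j → Definable (λ v → g j (v 0))) →
                      Definable (λ v → φ (λ j → g j (v 0)))
  compose-definable {φ} g (A , A-expr , A≗φ) g-definable =
    definable-≗ (subst-definable N (stage N ≤-refl) (var-definable 0))
      (λ v → trans (⟦⟧-local A (θ-final v)) (A≗φ (λ j → g j (v 0))))
    where
    N : ℕ
    N = support A

    θ : ℕ → Valuation → Valuation
    θ i v j with j <? i
    ... | yes _ = g j (v N)
    ... | no _ = v j

    θ-zero : ∀ v j → v j ≡ θ 0 v j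
    θ-zero v j with j <? 0
    ... | no _ = refl

    θ-step : ∀ {i} → i < N → ∀ v j → θ i (v [ i ↦ g i (v N) ]) j ≡ θ (suc i) v j
    θ-step {i} i<N v j with j <? i | j <? suc i
    ... | yes _ | yes _ = cong (g j) (set-other v _ (<⇒≢ i<N ∘ sym))
    ... | yes j<i | no j≮1+i = contradiction (m<n⇒m<1+n j<i) j≮1+i
    ... | no j≮i | yes j<1+i rewrite ≤-antisym (≤-pred j<1+i) (≮⇒≥ j≮i) = set-same v i _
    ... | no _ | no j≮1+i = set-other v _ (λ j≡i → j≮1+i (≤-reflexive (cong suc j≡i)))

    θ-final : ∀ v j → j < N → θ N (v [ N ↦ v 0 ]) j ≡ g j (v 0)
    θ-final v j j<N with j <? N
    ... | yes _ = cong (g j) (set-same v N (v 0))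
    ... | no j≮N = contradiction j<N j≮N

    g-at-N : ∀ j → Definable (λ v → g j (v N))
    g-at-N j = definable-≗ (subst-definable 0 (g-definable j) (var-definable N))
                           (λ v → cong (g j) (set-same v 0 (v N)))

    stage : ∀ i → i ≤ N → Definable (λ v → ⟦ A ⟧ (θ i v))
    stage zero _ = definable-≗ (⟦⟧-definable A-expr) (λ v → ⟦⟧-cong A (θ-zero v))
    stage (suc i) i<N = definable-≗ (subst-definable i (stage i (<⇒≤ i<N)) (g-at-N i))
                                    (λ v → ⟦⟧-cong A (θ-step i<N v))

  record Op : Set where
    field
      fun : B2 → B2
      fun-definable : Definable (λ v → fun (v 0))
  open Op public

  idᵒ : Op
  idᵒ = record { fun = λ x → x ; fun-definable = var-definable 0 }

  _∘ᵒ_ : Op → Op → Op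
  t ∘ᵒ s = record
    { fun = fun t ∘ fun s
    ; fun-definable = definable-≗ (subst-definable 0 (fun-definable t) (fun-definable s))
                                  (λ v → cong (fun t) (set-same v 0 _))
    }

  plug : ∀ {F} → Expressible Fs F → (ℕ → Op) → Op
  plug {F} F-expr ts = record
    { fun = λ x → ⟦ F ⟧ (λ j → fun (ts j) x)
    ; fun-definable = compose-definable (fun ∘ ts) (⟦⟧-definable F-expr) (fun-definable ∘ ts)
    }

  fun-resp-∼ : ∀ t {x y} → x ∼ y → fun t x ∼ fun t y
  fun-resp-∼ t {x} {y} x∼y with fun-definable t
  ... | A , _ , A≗t = trans (cong upper (sym (A≗t (λ _ → x))))
                            (trans (⟦⟧-resp-∼ A (λ _ → x∼y)) (cong upper (A≗t (λ _ → y))))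

  const-op⇒ExpressibleConst : ∀ {c} (t : Op) → (∀ x → fun t x ≡ c) → ExpressibleConst Fs c
  const-op⇒ExpressibleConst {c} t t≡c with fun-definable t
  ... | A , A-expr , A≗t =
    A , A-expr , ≗⇒Equiv {A} {constF c} λ v → trans (A≗t v) (trans (t≡c (v 0)) (sym (⟦constF⟧ c v)))

  constant-op : (∀ a b → Σ[ t ∈ Op ] fun t a ≡ fun t b) → Σ[ t ∈ Op ] ∀ x → fun t x ≡ fun t 𝟘
  constant-op merge with merge 𝟘 ρ
  ... | t₁ , e₁ with merge (fun t₁ ρ) (fun t₁ σ)
  ... | t₂ , e₂ with merge (fun (t₂ ∘ᵒ t₁) σ) (fun (t₂ ∘ᵒ t₁) 𝟙)
  ... | t₃ , e₃ = t₃ ∘ᵒ (t₂ ∘ᵒ t₁) , λ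
    { 𝟘 → refl
    ; ρ → cong (fun t₃ ∘ fun t₂) (sym e₁)
    ; σ → trans (cong (fun t₃) (sym e₂)) (cong (fun t₃ ∘ fun t₂) (sym e₁))
    ; 𝟙 → trans (sym e₃) (trans (cong (fun t₃) (sym e₂)) (cong (fun t₃ ∘ fun t₂) (sym e₁)))
    }

  Unpreserved : ∀ {m} → Relation m → Set
  Unpreserved R = Σ[ F ∈ Formula ] Expressible Fs F × ¬ Preserves R F

  Reachable : B2 → B2 → Set
  Reachable x y = Σ[ t ∈ Op ] fun t x ≡ y

  reachable-closed : ∀ {F x v} → Expressible Fs F → (∀ k → Reachable x (v k)) → Reachable x (⟦ F ⟧ v)
  reachable-closed {F} F-expr reach = plug F-expr (proj₁ ∘ reach) , ⟦⟧-cong F (proj₂ ∘ reach)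

  ProperSubsetsUnpreserved : Set
  ProperSubsetsUnpreserved =
    ∀ S → (∃ λ y → index y ∈ˢ S) → (∃ λ y → index y ∉ˢ S) → Unpreserved (unary (elements S))

  proper-subsets-unpreserved :
    Unpreserved R₁ → Unpreserved R₂ → Unpreserved R₃ → Unpreserved R₄ → Unpreserved R₅ →
    Unpreserved R₆ → Unpreserved R₇ → Unpreserved R₈ → Unpreserved R₉ → Unpreserved R₁₀ →
    ProperSubsetsUnpreserved
  proper-subsets-unpreserved u₁ u₂ u₃ u₄ u₅ u₆ u₇ u₈ u₉ u₁₀ = table
    where
    singleton : ∀ {xs x} → (∀ y → y ∈ xs ⇔ y ∼ x) → Unpreserved (unary xs) → Unpreserved (unary (x ∷ []))
    singleton class (F , F-expr , F-unpreserved) =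
      F , F-expr , singleton-unpreserved {F = F} class F-unpreserved

    table : ProperSubsetsUnpreserved
    table (outside ∷ outside ∷ outside ∷ outside ∷ []) (_ , y∈∅) _ = contradiction y∈∅ ∉⊥
    table (inside  ∷ inside  ∷ inside  ∷ inside  ∷ []) _ (_ , y∉𝔅₂) = contradiction ∈⊤ y∉𝔅₂
    table (inside  ∷ outside ∷ outside ∷ outside ∷ []) _ _ = singleton lower-class u₁
    table (outside ∷ inside  ∷ outside ∷ outside ∷ []) _ _ = singleton lower-class u₁
    table (outside ∷ outside ∷ inside  ∷ outside ∷ []) _ _ = singleton upper-class u₂
    table (outside ∷ outside ∷ outside ∷ inside  ∷ []) _ _ = singleton upper-class u₂
    table (inside  ∷ inside  ∷ outside ∷ outside ∷ []) _ _ = u₁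
    table (outside ∷ outside ∷ inside  ∷ inside  ∷ []) _ _ = u₂
    table (inside  ∷ outside ∷ inside  ∷ outside ∷ []) _ _ = u₃
    table (inside  ∷ outside ∷ outside ∷ inside  ∷ []) _ _ = u₄
    table (outside ∷ inside  ∷ inside  ∷ outside ∷ []) _ _ = u₅
    table (outside ∷ inside  ∷ outside ∷ inside  ∷ []) _ _ = u₆
    table (inside  ∷ inside  ∷ inside  ∷ outside ∷ []) _ _ = u₇
    table (inside  ∷ inside  ∷ outside ∷ inside  ∷ []) _ _ = u₈
    table (inside  ∷ outside ∷ inside  ∷ inside  ∷ []) _ _ = u₉
    table (outside ∷ inside  ∷ inside  ∷ inside  ∷ []) _ _ = u₁₀

  module _ (proper-unpreserved : ProperSubsetsUnpreserved) where

    saturate : ∀ {x} S → Acc _⊃ˢ_ S → (∃ λ y → index y ∈ˢ S) → (∀ y → index y ∈ˢ S → Reachable x y) →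
               ∀ y → Reachable x y
    saturate {x} S (acc larger) nonempty@(y₀ , y₀∈S) reached with search-B2 (λ y → ¬? (index y ∈? S))
    ... | no ∄missing = λ y → reached y (decidable-stable (index y ∈? S) (∄missing ∘ (y ,_)))
    ... | yes missing with proper-unpreserved S nonempty missing
    ... | F , F-expr , F-unpreserved
      with counterexample₁ (λ y → index y ∈? S) {y₀} y₀∈S F
             (F-unpreserved ∘ Preserves-resp-≐ (elements≐ S) {F})
    ... | v , v∈S , Fv∉S = saturate S′ (larger S⊂S′) (⟦ F ⟧ v , new∈S′) reached′
      where
      S′ : Subset 4
      S′ = S ∪ ⁅ index (⟦ F ⟧ v) ⁆
      new∈S′ : index (⟦ F ⟧ v) ∈ˢ S′
      new∈S′ = x∈p∪q⁺ (inj₂ (x∈⁅x⁆ _))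
      S⊂S′ : S ⊂ˢ S′
      S⊂S′ = p⊆p∪q _ , index (⟦ F ⟧ v) , new∈S′ , Fv∉S
      reached′ : ∀ y → index y ∈ˢ S′ → Reachable x y
      reached′ y y∈S′ with x∈p∪q⁻ S _ y∈S′
      ... | inj₁ y∈S = reached y y∈S
      ... | inj₂ y∈new = subst (Reachable x) (sym (index-injective (x∈⁅y⁆⇒x≡y _ y∈new)))
                           (reachable-closed F-expr (λ k → reached (v k) (v∈S k)))

    reachable : ∀ x y → Reachable x y
    reachable x = saturate ⁅ index x ⁆ (⊃-wellFounded _) (x , x∈⁅x⁆ _)
                    (λ y y∈ → idᵒ , sym (index-injective (x∈⁅y⁆⇒x≡y _ y∈)))

    toward : B2 → B2 → Op
    toward x y = proj₁ (reachable x y)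

    toward-maps : ∀ x y → fun (toward x y) x ≡ y
    toward-maps x y = proj₂ (reachable x y)

    collapse : Unpreserved R₁₁ → ∀ {a b} → a ∼ b → Σ[ t ∈ Op ] fun t a ≡ fun t b
    collapse (F , F-expr , F-unpreserved) {a} {b} a∼b with search-B2 (λ x → fun (toward a x) b ≟ x)
    ... | yes (x , fixes) = toward a x , trans (toward-maps a x) (sym fixes)
    ... | no ∄fixed with τ-counterexample F F-unpreserved
    ... | c , Fτc≢τFc = w , w-merges
      where
      swaps : ∀ x → fun (toward a x) b ≡ τ x
      swaps x
        with same-class x _ (trans (fun-resp-∼ (toward a x) (sym a∼b)) (cong upper (toward-maps a x)))
      ... | inj₁ fixes = contradiction (x , fixes) ∄fixed
      ... | inj₂ swapped = swapped
      w : Op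
      w = plug F-expr (toward a ∘ c)
      w-a : fun w a ≡ ⟦ F ⟧ c
      w-a = ⟦⟧-cong F (toward-maps a ∘ c)
      w-b : fun w b ≡ ⟦ F ⟧ (τ ∘ c)
      w-b = ⟦⟧-cong F (swaps ∘ c)
      w-merges : fun w a ≡ fun w b
      w-merges with same-class (fun w a) (fun w b) (fun-resp-∼ w (sym a∼b))
      ... | inj₁ merged = sym merged
      ... | inj₂ swapped = contradiction (trans (sym w-b) (trans swapped (cong τ w-a))) Fτc≢τFc

    meet : Unpreserved R₁₂ → ∀ a b → Σ[ t ∈ Op ] fun t a ∼ fun t b
    meet (F , F-expr , F-unpreserved) a b with fun (toward a 𝟙) b ∼? 𝟙 | fun (toward a 𝟘) b ∼? 𝟘
    ... | yes b↦upper | _ = toward a 𝟙 , trans (cong upper (toward-maps a 𝟙)) (sym b↦upper)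
    ... | _ | yes b↦lower = toward a 𝟘 , trans (cong upper (toward-maps a 𝟘)) (sym b↦lower)
    ... | no 𝟙-swaps-b | no 𝟘-swaps-b with class-merging-counterexample F F-unpreserved
    ... | v , w , v≁w , Fv∼Fw = s , trans s-a (trans Fv∼Fw (sym s-b))
      where
      pick : Bool → Op
      pick true = toward a 𝟙
      pick false = toward a 𝟘
      pick-a : ∀ p → upper (fun (pick p) a) ≡ p
      pick-a true = cong upper (toward-maps a 𝟙)
      pick-a false = cong upper (toward-maps a 𝟘)
      pick-b : ∀ p → upper (fun (pick p) b) ≡ not p
      pick-b true = ¬-not 𝟙-swaps-b
      pick-b false = ¬-not 𝟘-swaps-b
      s : Op
      s = plug F-expr (pick ∘ upper ∘ v)
      s-a : fun s a ∼ ⟦ F ⟧ v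
      s-a = ⟦⟧-resp-∼ F (pick-a ∘ upper ∘ v)
      s-b : fun s b ∼ ⟦ F ⟧ w
      s-b = ⟦⟧-resp-∼ F (λ j → trans (pick-b (upper (v j))) (sym (¬-not (v≁w j ∘ sym))))

    merge : Unpreserved R₁₁ → Unpreserved R₁₂ → ∀ a b → Σ[ t ∈ Op ] fun t a ≡ fun t b
    merge unpreserved₁₁ unpreserved₁₂ a b with meet unpreserved₁₂ a b
    ... | s , s-meets with collapse unpreserved₁₁ s-meets
    ... | t , t-merges = t ∘ᵒ s , t-merges

    constants-expressible : Unpreserved R₁₁ → Unpreserved R₁₂ → ∀ c → ExpressibleConst Fs c
    constants-expressible unpreserved₁₁ unpreserved₁₂ =
      from-constant (constant-op (merge unpreserved₁₁ unpreserved₁₂))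
      where
      from-constant : (Σ[ K ∈ Op ] ∀ x → fun K x ≡ fun K 𝟘) → ∀ c → ExpressibleConst Fs c
      from-constant (K , K-constant) c = const-op⇒ExpressibleConst (toward (fun K 𝟘) c ∘ᵒ K) λ x →
        trans (cong (fun (toward (fun K 𝟘) c)) (K-constant x)) (toward-maps (fun K 𝟘) c)

theorem2 : (F₁ F₂ F₃ F₄ F₅ F₆ F₇ F₈ F₉ F₁₀ F₁₁ F₁₂ : Formula) →
    ¬ Preserves R₁ F₁ → ¬ Preserves R₂ F₂ → ¬ Preserves R₃ F₃ →
    ¬ Preserves R₄ F₄ → ¬ Preserves R₅ F₅ → ¬ Preserves R₆ F₆ →
    ¬ Preserves R₇ F₇ → ¬ Preserves R₈ F₈ → ¬ Preserves R₉ F₉ →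
    ¬ Preserves R₁₀ F₁₀ → ¬ Preserves R₁₁ F₁₁ → ¬ Preserves R₁₂ F₁₂ →
    (c : B2) →
    ExpressibleConst (family12 F₁ F₂ F₃ F₄ F₅ F₆ F₇ F₈ F₉ F₁₀ F₁₁ F₁₂) c
theorem2 F₁ F₂ F₃ F₄ F₅ F₆ F₇ F₈ F₉ F₁₀ F₁₁ F₁₂ h₁ h₂ h₃ h₄ h₅ h₆ h₇ h₈ h₉ h₁₀ h₁₁ h₁₂ =
  constants-expressible
    (proper-subsets-unpreserved
      (F₁ , ex-base (# 0) , h₁) (F₂ , ex-base (# 1) , h₂) (F₃ , ex-base (# 2) , h₃)
      (F₄ , ex-base (# 3) , h₄) (F₅ , ex-base (# 4) , h₅) (F₆ , ex-base (# 5) , h₆)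
      (F₇ , ex-base (# 6) , h₇) (F₈ , ex-base (# 7) , h₈) (F₉ , ex-base (# 8) , h₉)
      (F₁₀ , ex-base (# 9) , h₁₀))
    (F₁₁ , ex-base (# 10) , h₁₁) (F₁₂ , ex-base (# 11) , h₁₂)
  where open Definability (family12 F₁ F₂ F₃ F₄ F₅ F₆ F₇ F₈ F₉ F₁₀ F₁₁ F₁₂)
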